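{- For every positive integer $n$ and every nonnegative integer $m$, \[ \sum_{k=0}^{n-1}\binom{k}{m}\mathbb{F}_{k}=\binom{n}{m+1}\mathbb{F}_{n}-\sum_{k=0}^{n-1}\binom{k+1}{m+1}\frac{1}{F_{k+1}}. \]
   Context: $F_n$ denotes the Fibonacci numbers: $F_0=0$, $F_1=1$, $F_{n+2}=F_{n+1}+F_n$. The $n$-th harmonic Fibonacci number is $\mathbb{F}_{n}=\sum_{k=1}^{n}\frac{1}{F_{k}}$ for $n\ge 1$, with $\mathbb{F}_0=0$ (empty sum). Binomial coefficients $\binom{k}{m}$ are $0$ when $k<m$. -}

module Defs where

open import Data.Nat using (ℕ; zero; suc; NonZero; _<_; z<s; s<s; >-nonZero)
import Data.Nat.Properties
open import Data.Nat.Combinatorics using (_C_)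
open import Data.Integer using (+_)
open import Data.Rational using (ℚ; _/_; 0ℚ; _+_; _*_)

fib : ℕ → ℕ
fib zero = 0
fib (suc zero) = 1
fib (suc (suc n)) = fib (suc n) Data.Nat.+ fib n

fib-suc-pos : ∀ k → 0 < fib (suc k)
fib-suc-pos zero = s<s Data.Nat.z≤n
fib-suc-pos (suc k) = Data.Nat.Properties.<-≤-trans (fib-suc-pos k) (Data.Nat.Properties.m≤m+n (fib (suc k)) (fib k))

invFibSuc : ℕ → ℚ
invFibSuc k = (+ 1) / fib (suc k)
  where instance _ = >-nonZero (fib-suc-pos k)

-- harmonic Fibonacci number: 𝔽 n = Σ_{k=1}^{n} 1 / F k  (𝔽 0 = 0)
harmFib : ℕ → ℚ
harmFib zero = 0ℚ
harmFib (suc n) = harmFib n + invFibSuc n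

sumTo : ℕ → (ℕ → ℚ) → ℚ
sumTo zero f = 0ℚ
sumTo (suc n) f = sumTo n f + f n

binomℚ : ℕ → ℕ → ℚ
binomℚ k m = (+ (k C m)) / 1

{-# OPTIONS --safe #-}
module Submission where

-- Summation by parts: the binomials bₖ = C(k, m+1) satisfy bₖ₊₁ − bₖ = C(k, m) by Pascal's
-- rule, and 𝔽ₖ₊₁ − 𝔽ₖ = 1/Fₖ₊₁, so Abel summation of Σ C(k, m) 𝔽ₖ gives the identity.

open import Defs
open import Data.Nat using (ℕ; zero; suc; _≤_)
import Data.Nat as ℕ
import Data.Nat.Properties as ℕₚ
open import Data.Nat.Combinatorics using (_C_; nCk+nC[k+1]≡[n+1]C[k+1])
open import Data.Integer using (+_)
import Data.Integer as ℤ
import Data.Integer.Properties as ℤₚ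
import Data.Nat.Coprimality as Coprimality
open import Data.Rational using (ℚ; mkℚ; _/_; 0ℚ; _+_; _-_; _*_)
open import Data.Rational.Properties using (normalize-coprime; _≟_; +-*-commutativeRing)
open import Data.Maybe using (Maybe; just; nothing)
open import Relation.Nullary using (yes; no)
open import Relation.Binary.PropositionalEquality using (_≡_; refl; cong; cong₂; sym; trans)
open import Tactic.RingSolver using (solve-∀)
open import Tactic.RingSolver.Core.AlmostCommutativeRing using (AlmostCommutativeRing; fromCommutativeRing)
open import Level using (0ℓ)

ℚ-almostCommutativeRing : AlmostCommutativeRing 0ℓ 0ℓ
ℚ-almostCommutativeRing = fromCommutativeRing +-*-commutativeRing is0ℚ
  where
  is0ℚ : ∀ x → Maybe (0ℚ ≡ x)
  is0ℚ x with 0ℚ ≟ x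
  ... | yes 0≡x = just 0≡x
  ... | no  _   = nothing

zero-times-minus-zero : ∀ (h : ℚ) → 0ℚ ≡ 0ℚ * h - 0ℚ
zero-times-minus-zero = solve-∀ ℚ-almostCommutativeRing

summation-by-parts-step : ∀ (b c h a t : ℚ) →
  (b * h - t) + c * h ≡ (b + c) * (h + a) - (t + (b + c) * a)
summation-by-parts-step = solve-∀ ℚ-almostCommutativeRing

summation-by-parts : ∀ (c b a h : ℕ → ℚ) → b 0 ≡ 0ℚ →
  (∀ k → b (suc k) ≡ b k + c k) → (∀ k → h (suc k) ≡ h k + a k) →
  ∀ n → sumTo n (λ k → c k * h k) ≡ b n * h n - sumTo n (λ k → b (suc k) * a k)
summation-by-parts c b a h b0≡0 Δb Δh zero
  rewrite b0≡0 = zero-times-minus-zero (h 0)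
summation-by-parts c b a h b0≡0 Δb Δh (suc n)
  rewrite summation-by-parts c b a h b0≡0 Δb Δh n | Δb n | Δh n =
  summation-by-parts-step (b n) (c n) (h n) (a n) (sumTo n (λ k → b (suc k) * a k))

ℕ/1≡mkℚ : ∀ x → + x / 1 ≡ mkℚ (+ x) 0 (Coprimality.sym (Coprimality.1-coprimeTo x))
ℕ/1≡mkℚ x = normalize-coprime (Coprimality.sym (Coprimality.1-coprimeTo x))

ℕ/1-homo-+ : ∀ x y → + (x ℕ.+ y) / 1 ≡ + x / 1 + + y / 1
ℕ/1-homo-+ x y rewrite ℕ/1≡mkℚ x | ℕ/1≡mkℚ y =
  cong (_/ 1) (sym (cong₂ ℤ._+_ (ℤₚ.*-identityʳ (+ x)) (ℤₚ.*-identityʳ (+ y))))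

binomℚ-pascal : ∀ n m → binomℚ (suc n) (suc m) ≡ binomℚ n (suc m) + binomℚ n m
binomℚ-pascal n m =
  trans (cong (λ z → + z / 1)
               (trans (sym (nCk+nC[k+1]≡[n+1]C[k+1] n m)) (ℕₚ.+-comm (n C m) (n C suc m))))
        (ℕ/1-homo-+ (n C suc m) (n C m))

mainTheorem3 : (n : ℕ) → (m : ℕ) → 1 ≤ n →
    sumTo n (λ k → binomℚ k m * harmFib k)
      ≡ binomℚ n (suc m) * harmFib n
        - sumTo n (λ k → binomℚ (suc k) (suc m) * invFibSuc k)
-- The identity also holds for n = 0.
mainTheorem3 n m _ =
  summation-by-parts (λ k → binomℚ k m) (λ k → binomℚ k (suc m)) invFibSuc harmFib
    refl (λ k → binomℚ-pascal k m) (λ _ → refl) n
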